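{- Let $\mathbf H$ be a connected Hopf monoid linearized in the basis $\mathbf h$, $I$ a finite set, $\alpha,\beta\in\mathbf l[I]$, $x,y\in\mathbf h[I]$, and suppose $\mathcal C_{\alpha,x}^{\beta,y}\neq\emptyset$ with unique minimal element $\Lambda$ under refinement. Then for every $A\in\mathcal C_{\alpha,x}^{\beta,y}$ the interval $[\Lambda,A]=\{B\models I:\Lambda\le B\le A\}$ is contained in $\mathcal C_{\alpha,x}^{\beta,y}$.
   Context: Work over a field of characteristic $0$. A connected Hopf monoid in vector species $\mathbf H$ has products $\mu_{A_1,A_2}:\mathbf H[A_1]\otimes\mathbf H[A_2]\to\mathbf H[I]$ and coproducts $\Delta_{A_1,A_2}:\mathbf H[I]\to\mathbf H[A_1]\otimes\mathbf H[A_2]$ for ordered decompositions $I=A_1\sqcup A_2$, satisfying associativity, coassociativity and compatibility axioms. It is linearized in the basis $\mathbf h$ if products send basis pairs to basis elements and coproducts send basis elements to $0$ or to a tensor of basis elements. A set composition $A=(A_1,\dots,A_k)\models I$ is a sequence of nonempty disjoint subsets with union $I$, $\ell(A)=k$; $\mu_A,\Delta_A$ denote the iterated product and coproduct. $A\le B$ ($A$ refines $B$) if every part of $B$ is a union of consecutive parts of $A$. For a linear order $\alpha$ on $I$, $\alpha_A=\alpha|_{A_1}\cdots\alpha|_{A_k}$ (concatenation of restrictions); for $x\in\mathbf h[I]$ with $\Delta_A(x)\ne0$, $x_A=\mu_A\Delta_A(x)$. $\mathcal C_{\alpha,x}^{\beta,y}=\{A\models I:\Delta_A(x)\neq0,\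 \alpha_A=\beta,\ x_A=y\}$; when nonempty it has a unique minimal element under refinement. -}

module Defs where

open import Level using (Level; suc; _⊔_)
open import Data.Bool using (Bool; true; false; T)
open import Data.Nat using (ℕ)
open import Data.Fin using (Fin)
open import Data.Fin.Subset using (Subset; Nonempty; _∪_) renaming (⊥ to ∅; _∈_ to _∈ˢ_)
open import Data.Fin.Subset.Properties using (_∈?_)
open import Data.Vec using ([]; _∷_)
open import Data.List using (List; []; _∷_; concat; map; filter; foldr)
open import Data.List.Membership.Propositional using (_∈_)
open import Data.List.Relation.Unary.Unique.Propositional using (Unique)
open import Data.List.Relation.Unary.All using (All)
open import Data.Maybe using (Maybe; just; nothing; _>>=_) renaming (map to mapᵐ)
open import Data.Product using (Σ; _×_; _,_)
open import Data.Unit using (⊤)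
open import Relation.Binary.PropositionalEquality using (_≡_; _≢_)
open import Function.Bundles using (_⇔_)

-- Subsets of a finite ground set Fin n and ordered decompositions.
-- Split S T U  means  S = T ⊔ U  (T, U disjoint with union S).

splitᵇ : Bool → Bool → Bool → Bool
splitᵇ true  true  false = true
splitᵇ true  false true  = true
splitᵇ false false false = true
splitᵇ _     _     _     = false

Split : ∀ {n} → Subset n → Subset n → Subset n → Set
Split []      []      []      = ⊤
Split (s ∷ S) (t ∷ A) (u ∷ B) = T (splitᵇ s t u) × Split S A B

-- Basis level: products send basis pairs to basis elements; coproducts
-- send a basis element to 0 (nothing) or to a tensor of basis elements
-- (just (a , b)).  Since tensors of basis elements are nonzero and
-- linearly independent, all axioms are exactly the basis-level equations.

record LinHopfMonoid (n : ℕ) (ℓ : Level) : Set (suc ℓ) where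
  field
    h : Subset n → Set ℓ
    μ : ∀ {S A B} → Split S A B → h A → h B → h S
    Δ : ∀ {S A B} → Split S A B → h S → Maybe (h A × h B)
    -- connectedness: H[∅] is one-dimensional, spanned by the unit
    one      : h ∅
    one-uniq : ∀ (e : h ∅) → e ≡ one
    unitˡ   : ∀ {S} (p : Split S ∅ S) (x : h S) → μ p one x ≡ x
    unitʳ   : ∀ {S} (p : Split S S ∅) (x : h S) → μ p x one ≡ x
    counitˡ : ∀ {S} (p : Split S ∅ S) (x : h S) → Δ p x ≡ just (one , x)
    counitʳ : ∀ {S} (p : Split S S ∅) (x : h S) → Δ p x ≡ just (x , one)
    assoc : ∀ {S A B C U X}
      (p : Split S A U) (q : Split U B C) (r : Split S X C) (s : Split X A B)
      (a : h A) (b : h B) (c : h C) →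
      μ p a (μ q b c) ≡ μ r (μ s a b) c
    coassoc : ∀ {S A B C U X}
      (p : Split S A U) (q : Split U B C) (r : Split S X C) (s : Split X A B)
      (x : h S) →
      (Δ p x >>= λ { (a , u) → Δ q u >>= λ { (b , c) → just (a , b , c) } })
      ≡ (Δ r x >>= λ { (v , c) → Δ s v >>= λ { (a , b) → just (a , b , c) } })
    -- compatibility:  S = A ⊔ B = C ⊔ D,  with
    -- A = P ⊔ Q, B = R ⊔ W, C = P ⊔ R, D = Q ⊔ W
    -- (which forces P = A∩C, Q = A∩D, R = B∩C, W = B∩D)
    compat : ∀ {S A B C D P Q R W}
      (m : Split S A B) (d : Split S C D)
      (dA : Split A P Q) (dB : Split B R W)
      (mC : Split C P R) (mD : Split D Q W)
      (a : h A) (b : h B) →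
      Δ d (μ m a b)
      ≡ (Δ dA a >>= λ { (a₁ , a₂) → Δ dB b >>= λ { (b₁ , b₂) →
           just (μ mC a₁ b₁ , μ mD a₂ b₂) } })

data Comp {n : ℕ} : Subset n → Set where
  [_]  : ∀ {S} → Nonempty S → Comp S
  cons : ∀ {S} (A : Subset n) {U} → Split S A U → Nonempty A → Comp U → Comp S

blocks : ∀ {n} {S : Subset n} → Comp S → List (Subset n)
blocks {S = S} [ _ ]   = S ∷ []
blocks (cons A _ _ F)  = A ∷ blocks F

ℓ-comp : ∀ {n} {S : Subset n} → Comp S → ℕ
ℓ-comp F = Data.List.length (blocks F)

⋃ : ∀ {n} → List (Subset n) → Subset n
⋃ = foldr _∪_ ∅

-- A ≤ B : every block of B is a union of (nonempty runs of) consecutive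
-- blocks of A.
_≼_ : ∀ {n} {S : Subset n} → Comp S → Comp S → Set
_≼_ {n} F G = Σ (List (List (Subset n))) λ Gs →
  All (λ g → g ≢ []) Gs × concat Gs ≡ blocks F × map ⋃ Gs ≡ blocks G

IsLinOrd : ∀ {n} → Subset n → List (Fin n) → Set
IsLinOrd I α = Unique α × (∀ i → (i ∈ α) ⇔ (i ∈ˢ I))

restrict : ∀ {n} → List (Fin n) → Subset n → List (Fin n)
restrict α A = filter (λ i → i ∈? A) α

orderOn : ∀ {n} {S : Subset n} → List (Fin n) → Comp S → List (Fin n)
orderOn α F = concat (map (restrict α) (blocks F))

module Iterated {n ℓ} (H : LinHopfMonoid n ℓ) where
  open LinHopfMonoid H

  Tup : ∀ {S} → Comp S → Set ℓ
  Tup {S} [ _ ]        = h S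
  Tup (cons A _ _ F)   = h A × Tup F

  μ* : ∀ {S} (F : Comp S) → Tup F → h S
  μ* [ _ ]          x       = x
  μ* (cons A p _ F) (a , t) = μ p a (μ* F t)

  Δ* : ∀ {S} (F : Comp S) → h S → Maybe (Tup F)
  Δ* [ _ ]          x = just x
  Δ* (cons A p _ F) x = Δ p x >>= λ { (a , u) → mapᵐ (λ t → (a , t)) (Δ* F u) }

  -- x_F = μ_F Δ_F (x), as a partial value (nothing iff Δ_F(x) = 0)
  cut : ∀ {S} (F : Comp S) → h S → Maybe (h S)
  cut F x = mapᵐ (μ* F) (Δ* F x)

  InC : ∀ {I} → List (Fin n) → h I → List (Fin n) → h I → Comp I → Set ℓ
  InC α x β y F = (Δ* F x ≢ nothing) × (orderOn α F ≡ β) × (cut F x ≡ just y)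

-- Write x_A = μ_A Δ_A x for the cut of x along A. Compatibility together with the unit and counit
-- laws gives Δ_p ∘ μ_p = id on basis tensors, and coassociativity/associativity let the cut along a
-- composition factor through any splitting of its blocks into an initial and a final segment.
-- Induction along the coarser composition then shows, for F ≤ G, that (x_G)_F = x_F and, when x_F
-- is defined, (x_F)_G = x_F. So for Λ ≤ B ≤ A in C we get x_B = (x_A)_B = y_B = (x_Λ)_B = x_Λ = y.
-- For the orders: restricting a word blockwise along G sends α_K to α_G when G ≤ K and fixes α_F
-- when F ≤ G, because the blocks of a composition are pairwise disjoint; hence
-- α_B = (α_A)_B = (α_Λ)_B = α_Λ = β.

module Submission where

open import Defs
open import Level using (Level)
open import Data.Bool using (Bool; true; false; T)
open import Data.Bool.Properties using (T-irrelevant)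
open import Data.Nat using (ℕ)
open import Data.Fin using (Fin)
open import Data.Fin.Subset using (Subset; Nonempty; _∪_; _⊆_; _∉_) renaming (⊥ to ∅; _∈_ to _∈ˢ_)
open import Data.Fin.Subset.Properties using (_∈?_; ∪-identityʳ; p⊆p∪q; q⊆p∪q)
open import Data.Vec using ([]; _∷_; here; there)
open import Data.List using (List; []; _∷_; _++_; concat; map)
open import Data.List.Properties
  using (filter-++; filter-all; filter-none; filter-reject; map-++; concat-++; ++-identityʳ; ∷-injectiveˡ; ∷-injectiveʳ)
open import Data.List.Relation.Unary.All as All using (All; []; _∷_)
open import Data.List.Relation.Unary.All.Properties using (all-filter; concat⁺; map⁺; map⁻)
open import Data.List.Relation.Unary.AllPairs using (AllPairs; []; _∷_)
open import Data.Maybe using (Maybe; just; nothing; _>>=_) renaming (map to mapᵐ)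
open import Data.Product using (Σ; ∃-syntax; _×_; _,_)
open import Data.Unit using (tt)
open import Relation.Nullary using (yes; no; contradiction)
open import Relation.Binary.PropositionalEquality

data SplitView : Bool → Bool → Bool → Set where
  inˡ : SplitView true true false
  inʳ : SplitView true false true
  out : SplitView false false false

split-view : ∀ {s a u} → T (splitᵇ s a u) → SplitView s a u
split-view {true}  {true}  {false} _ = inˡ
split-view {true}  {false} {true}  _ = inʳ
split-view {false} {false} {false} _ = out
split-view {true}  {true}  {true}  ()
split-view {true}  {false} {false} ()
split-view {false} {true}  {_}     ()
split-view {false} {false} {true}  ()

split-irrelevant : ∀ {n} {S A U : Subset n} (p q : Split S A U) → p ≡ q
split-irrelevant {S = []} {A = []} {U = []} tt      tt      = refl
split-irrelevant {S = _ ∷ _} {A = _ ∷ _} {U = _ ∷ _} (b , p) (c , q) =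
  cong₂ _,_ (T-irrelevant b c) (split-irrelevant p q)

split-determinesʳ : ∀ {n} {S A U U' : Subset n} → Split S A U → Split S A U' → U ≡ U'
split-determinesʳ {S = []} {A = []} {U = []} {U' = []} _       _       = refl
split-determinesʳ {S = _ ∷ _} {A = _ ∷ _} {U = _ ∷ _} {U' = _ ∷ _} (b , p) (c , q)
  with split-view b | split-view c
... | inˡ | inˡ = cong (false ∷_) (split-determinesʳ p q)
... | inʳ | inʳ = cong (true ∷_)  (split-determinesʳ p q)
... | out | out = cong (false ∷_) (split-determinesʳ p q)

split-∪ : ∀ {n} {S A U : Subset n} → Split S A U → A ∪ U ≡ S
split-∪ {S = []} {A = []} {U = []} _       = refl
split-∪ {S = _ ∷ _} {A = _ ∷ _} {U = _ ∷ _} (b , p) with split-view b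
... | inˡ = cong (true ∷_)  (split-∪ p)
... | inʳ = cong (true ∷_)  (split-∪ p)
... | out = cong (false ∷_) (split-∪ p)

split-⊆ˡ : ∀ {n} {S A U : Subset n} → Split S A U → A ⊆ S
split-⊆ˡ {U = U} p = subst (_ ⊆_) (split-∪ p) (p⊆p∪q U)

split-⊆ʳ : ∀ {n} {S A U : Subset n} → Split S A U → U ⊆ S
split-⊆ʳ {A = A} {U} p = subst (_ ⊆_) (split-∪ p) (q⊆p∪q A U)

Disjoint : ∀ {n} → Subset n → Subset n → Set
Disjoint S T = ∀ {i} → i ∈ˢ S → i ∉ T

disjoint-sym : ∀ {n} {S T : Subset n} → Disjoint S T → Disjoint T S
disjoint-sym d i∈T i∈S = d i∈S i∈T

split-disjoint : ∀ {n} {S A U : Subset n} → Split S A U → Disjoint A U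
split-disjoint {S = _ ∷ _} {A = _ ∷ _} {U = _ ∷ _} (b , _) here      here      with split-view b
... | ()
split-disjoint {S = _ ∷ _} {A = _ ∷ _} {U = _ ∷ _} (b , p) (there i) (there j) = split-disjoint p i j

split-assoc : ∀ {n} {S A V B W : Subset n} → Split S A V → Split V B W →
  ∃[ Y ] Split S Y W × Split Y A B
split-assoc {S = []} {A = []} {V = []} {B = []} {W = []} _       _       = [] , tt , tt
split-assoc {S = _ ∷ _} {A = _ ∷ _} {V = _ ∷ _} {B = _ ∷ _} {W = _ ∷ _} (b , p) (c , q)
  with split-view b | split-view c | split-assoc p q
... | inˡ | out | Y , r , s = true  ∷ Y , (tt , r) , (tt , s)
... | inʳ | inˡ | Y , r , s = true  ∷ Y , (tt , r) , (tt , s)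
... | inʳ | inʳ | Y , r , s = false ∷ Y , (tt , r) , (tt , s)
... | out | out | Y , r , s = false ∷ Y , (tt , r) , (tt , s)

split-∅ˡ : ∀ {n} {A : Subset n} → Split A ∅ A
split-∅ˡ {A = []}        = tt
split-∅ˡ {A = true ∷ _}  = tt , split-∅ˡ
split-∅ˡ {A = false ∷ _} = tt , split-∅ˡ

split-∅ʳ : ∀ {n} {A : Subset n} → Split A A ∅
split-∅ʳ {A = []}        = tt
split-∅ʳ {A = true ∷ _}  = tt , split-∅ʳ
split-∅ʳ {A = false ∷ _} = tt , split-∅ʳ

⋃-blocks : ∀ {n} {S : Subset n} (C : Comp S) → ⋃ (blocks C) ≡ S
⋃-blocks {S = S} [ _ ]     = ∪-identityʳ S
⋃-blocks (cons A p _ F)    = trans (cong (A ∪_) (⋃-blocks F)) (split-∪ p)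

blocks-⊆ : ∀ {n} {S : Subset n} (C : Comp S) → All (_⊆ S) (blocks C)
blocks-⊆ [ _ ]          = (λ i∈S → i∈S) ∷ []
blocks-⊆ (cons _ p _ F) =
  split-⊆ˡ p ∷ All.map (λ b⊆U {_} i∈b → split-⊆ʳ p (b⊆U i∈b)) (blocks-⊆ F)

blocks-disjoint : ∀ {n} {S : Subset n} (C : Comp S) → AllPairs Disjoint (blocks C)
blocks-disjoint [ _ ]          = [] ∷ []
blocks-disjoint (cons _ p _ F) =
  All.map (λ b⊆U {_} i∈A i∈b → split-disjoint p i∈A (b⊆U i∈b)) (blocks-⊆ F) ∷ blocks-disjoint F

⊆-⋃ : ∀ {n} (bs : List (Subset n)) → All (_⊆ ⋃ bs) bs
⊆-⋃ []       = []
⊆-⋃ (b ∷ bs) =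
  p⊆p∪q (⋃ bs) ∷ All.map (λ c⊆ {_} i∈c → q⊆p∪q b (⋃ bs) (c⊆ i∈c)) (⊆-⋃ bs)

⋃-disjoint : ∀ {n} {T : Subset n} bs → Disjoint T (⋃ bs) → All (λ b → Disjoint b T) bs
⋃-disjoint bs d = All.map (λ b⊆ {_} i∈b i∈T → d i∈T (b⊆ i∈b)) (⊆-⋃ bs)

concat-disjoint : ∀ {n} {T : Subset n} (Gs : List (List (Subset n))) →
  All (Disjoint T) (map ⋃ Gs) → All (λ b → Disjoint b T) (concat Gs)
concat-disjoint Gs d = concat⁺ (All.map (⋃-disjoint _) (map⁻ d))

concat-≢[] : ∀ {n} {S : Subset n} {Gs : List (List (Subset n))} (G : Comp S) →
  All (_≢ []) Gs → map ⋃ Gs ≡ blocks G → concat Gs ≢ []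
concat-≢[] {Gs = []}            [ _ ]            _              ()
concat-≢[] {Gs = []}            (cons _ _ _ _)   _              ()
concat-≢[] {Gs = [] ∷ _}        _                ([]≢[] ∷ _)    _  = contradiction refl []≢[]
concat-≢[] {Gs = (_ ∷ _) ∷ _}   _                _              _  ()

restrictAlong : ∀ {n} → List (Fin n) → List (Subset n) → List (Fin n)
restrictAlong w bs = concat (map (restrict w) bs)

module _ {n : ℕ} where

  restrict-++ : ∀ (u v : List (Fin n)) T → restrict (u ++ v) T ≡ restrict u T ++ restrict v T
  restrict-++ u v T = filter-++ (_∈? T) u v

  restrict-within : ∀ {P : Fin n → Set} {S} w → (∀ {i} → i ∈ˢ S → P i) → All P (restrict w S)
  restrict-within {S = S} w S⊆P = All.map S⊆P (all-filter (_∈? S) w)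

  restrictAlong-within : ∀ {P : Fin n → Set} w {bs} →
    All (λ b → ∀ {i} → i ∈ˢ b → P i) bs → All P (restrictAlong w bs)
  restrictAlong-within w bs⊆P = concat⁺ (map⁺ (All.map (restrict-within w) bs⊆P))

  restrict-restrictAlong-⊆ : ∀ w {bs} {T : Subset n} →
    All (_⊆ T) bs → restrict (restrictAlong w bs) T ≡ restrictAlong w bs
  restrict-restrictAlong-⊆ w {T = T} bs⊆T = filter-all (_∈? T) (restrictAlong-within w bs⊆T)

  restrict-restrictAlong-disjoint : ∀ w {bs} {T : Subset n} →
    All (λ b → Disjoint b T) bs → restrict (restrictAlong w bs) T ≡ []
  restrict-restrictAlong-disjoint w {T = T} d = filter-none (_∈? T) (restrictAlong-within w d)

  restrict-restrict-⊆ : ∀ w {S T : Subset n} → T ⊆ S → restrict (restrict w S) T ≡ restrict w T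
  restrict-restrict-⊆ []      T⊆S = refl
  restrict-restrict-⊆ (i ∷ w) {S} {T} T⊆S with i ∈? S
  ... | no i∉S =
    trans (restrict-restrict-⊆ w T⊆S) (sym (filter-reject (_∈? T) (λ i∈T → i∉S (T⊆S i∈T))))
  ... | yes _ with i ∈? T
  ...   | yes _ = cong (i ∷_) (restrict-restrict-⊆ w T⊆S)
  ...   | no _  = restrict-restrict-⊆ w T⊆S

  restrictAlong-restrict : ∀ w {bs} {T : Subset n} →
    All (_⊆ T) bs → restrictAlong (restrict w T) bs ≡ restrictAlong w bs
  restrictAlong-restrict w []            = refl
  restrictAlong-restrict w (b⊆T ∷ bs⊆T) =
    cong₂ _++_ (restrict-restrict-⊆ w b⊆T) (restrictAlong-restrict w bs⊆T)

  restrictAlong-++ : ∀ w (bs cs : List (Subset n)) →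
    restrictAlong w (bs ++ cs) ≡ restrictAlong w bs ++ restrictAlong w cs
  restrictAlong-++ w bs cs =
    trans (cong concat (map-++ (restrict w) bs cs)) (sym (concat-++ (map (restrict w) bs) _))

  restrictAlong-dropˡ : ∀ u v {ts : List (Subset n)} →
    All (λ t → restrict u t ≡ []) ts → restrictAlong (u ++ v) ts ≡ restrictAlong v ts
  restrictAlong-dropˡ u v []                = refl
  restrictAlong-dropˡ u v {t ∷ _} (e ∷ es) =
    cong₂ _++_ (trans (restrict-++ u v t) (cong (_++ _) e)) (restrictAlong-dropˡ u v es)

  restrictAlong-dropʳ : ∀ u v {ts : List (Subset n)} →
    All (λ t → restrict v t ≡ []) ts → restrictAlong (u ++ v) ts ≡ restrictAlong u ts
  restrictAlong-dropʳ u v []                = refl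
  restrictAlong-dropʳ u v {t ∷ _} (e ∷ es) = cong₂ _++_
    (trans (restrict-++ u v t) (trans (cong (_ ++_) e) (++-identityʳ _))) (restrictAlong-dropʳ u v es)

  restrictAlong-coarsen : ∀ w (Gs : List (List (Subset n))) → AllPairs Disjoint (map ⋃ Gs) →
    restrictAlong (restrictAlong w (concat Gs)) (map ⋃ Gs) ≡ restrictAlong w (concat Gs)
  restrictAlong-coarsen w []       []       = refl
  restrictAlong-coarsen w (g ∷ Gs) (d ∷ ds) = begin
    restrictAlong (restrictAlong w (g ++ concat Gs)) (⋃ g ∷ map ⋃ Gs)
      ≡⟨ cong (λ z → restrictAlong z (⋃ g ∷ map ⋃ Gs)) (restrictAlong-++ w g (concat Gs)) ⟩
    restrict (u ++ v) (⋃ g) ++ restrictAlong (u ++ v) (map ⋃ Gs)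
      ≡⟨ cong₂ _++_ first rest ⟩
    u ++ v
      ≡⟨ restrictAlong-++ w g (concat Gs) ⟨
    restrictAlong w (g ++ concat Gs) ∎
    where
    open ≡-Reasoning
    u = restrictAlong w g
    v = restrictAlong w (concat Gs)
    first : restrict (u ++ v) (⋃ g) ≡ u
    first = begin
      restrict (u ++ v) (⋃ g)
        ≡⟨ restrict-++ u v (⋃ g) ⟩
      restrict u (⋃ g) ++ restrict v (⋃ g)
        ≡⟨ cong₂ _++_ (restrict-restrictAlong-⊆ w (⊆-⋃ g))
                      (restrict-restrictAlong-disjoint w (concat-disjoint Gs d)) ⟩
      u ++ []
        ≡⟨ ++-identityʳ u ⟩
      u ∎
    rest : restrictAlong (u ++ v) (map ⋃ Gs) ≡ v
    rest = trans
      (restrictAlong-dropˡ u v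
        (All.map (λ {t} (d' : Disjoint (⋃ g) t) →
          restrict-restrictAlong-disjoint w (⋃-disjoint g (disjoint-sym d'))) d))
      (restrictAlong-coarsen w Gs ds)

  restrictAlong-refine : ∀ w (Gs : List (List (Subset n))) → AllPairs Disjoint (map ⋃ Gs) →
    restrictAlong (restrictAlong w (map ⋃ Gs)) (concat Gs) ≡ restrictAlong w (concat Gs)
  restrictAlong-refine w []       []       = refl
  restrictAlong-refine w (g ∷ Gs) (d ∷ ds) = begin
    restrictAlong (u ++ v) (g ++ concat Gs)
      ≡⟨ restrictAlong-++ (u ++ v) g (concat Gs) ⟩
    restrictAlong (u ++ v) g ++ restrictAlong (u ++ v) (concat Gs)
      ≡⟨ cong₂ _++_ first rest ⟩
    restrictAlong w g ++ restrictAlong w (concat Gs)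
      ≡⟨ restrictAlong-++ w g (concat Gs) ⟨
    restrictAlong w (g ++ concat Gs) ∎
    where
    open ≡-Reasoning
    u = restrict w (⋃ g)
    v = restrictAlong w (map ⋃ Gs)
    first : restrictAlong (u ++ v) g ≡ restrictAlong w g
    first = begin
      restrictAlong (u ++ v) g
        ≡⟨ restrictAlong-dropʳ u v (All.map (λ b⊆ → restrict-restrictAlong-disjoint w
             (All.map (λ {t} (d' : Disjoint (⋃ g) t) {_} i∈t i∈b → d' (b⊆ i∈b) i∈t) d))
             (⊆-⋃ g)) ⟩
      restrictAlong u g
        ≡⟨ restrictAlong-restrict w (⊆-⋃ g) ⟩
      restrictAlong w g ∎
    rest : restrictAlong (u ++ v) (concat Gs) ≡ restrictAlong w (concat Gs)
    rest = trans
      (restrictAlong-dropˡ u v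
        (All.map (λ {b} (d' : Disjoint b (⋃ g)) →
                    filter-none (_∈? b) (restrict-within w (disjoint-sym d')))
                 (concat-disjoint Gs d)))
      (restrictAlong-refine w Gs ds)

orderOn-coarsen : ∀ {n} {S : Subset n} w {F G : Comp S} → F ≼ G →
  restrictAlong (orderOn w F) (blocks G) ≡ orderOn w F
orderOn-coarsen w {F} {G} (Gs , _ , eF , eG) = begin
  restrictAlong (orderOn w F) (blocks G)
    ≡⟨ cong₂ (λ bs cs → restrictAlong (restrictAlong w bs) cs) eF eG ⟨
  restrictAlong (restrictAlong w (concat Gs)) (map ⋃ Gs)
    ≡⟨ restrictAlong-coarsen w Gs (subst (AllPairs Disjoint) (sym eG) (blocks-disjoint G)) ⟩
  restrictAlong w (concat Gs)
    ≡⟨ cong (restrictAlong w) eF ⟩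
  orderOn w F ∎
  where open ≡-Reasoning

orderOn-refine : ∀ {n} {S : Subset n} w {G K : Comp S} → G ≼ K →
  restrictAlong (orderOn w K) (blocks G) ≡ orderOn w G
orderOn-refine w {G} {K} (Gs , _ , eG , eK) = begin
  restrictAlong (orderOn w K) (blocks G)
    ≡⟨ cong₂ (λ bs cs → restrictAlong (restrictAlong w bs) cs) eK eG ⟨
  restrictAlong (restrictAlong w (map ⋃ Gs)) (concat Gs)
    ≡⟨ restrictAlong-refine w Gs (subst (AllPairs Disjoint) (sym eK) (blocks-disjoint K)) ⟩
  restrictAlong w (concat Gs)
    ≡⟨ cong (restrictAlong w) eG ⟩
  orderOn w G ∎
  where open ≡-Reasoning

orderOn-between : ∀ {n} {S : Subset n} w {F G K : Comp S} → F ≼ G → G ≼ K →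
  orderOn w F ≡ orderOn w K → orderOn w G ≡ orderOn w K
orderOn-between w {F} {G} {K} F≼G G≼K eq = begin
  orderOn w G                             ≡⟨ orderOn-refine w G≼K ⟨
  restrictAlong (orderOn w K) (blocks G)  ≡⟨ cong (λ v → restrictAlong v (blocks G)) eq ⟨
  restrictAlong (orderOn w F) (blocks G)  ≡⟨ orderOn-coarsen w F≼G ⟩
  orderOn w F                             ≡⟨ eq ⟩
  orderOn w K                             ∎
  where open ≡-Reasoning

module _ {a} {Y₁ Y₂ Y₃ R : Set a} (j : Y₁ → Y₂ → Y₃ → R) where

  liftA3 : Maybe Y₁ → Maybe Y₂ → Maybe Y₃ → Maybe R
  liftA3 m₁ m₂ m₃ = m₁ >>= λ y₁ → m₂ >>= λ y₂ → mapᵐ (j y₁ y₂) m₃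

  liftA3-nestʳ : ∀ {Z : Set a} {j₁ : Y₁ → Z → R} {j₂ : Y₂ → Y₃ → Z} →
    (∀ y₁ y₂ y₃ → j₁ y₁ (j₂ y₂ y₃) ≡ j y₁ y₂ y₃) → ∀ m₁ m₂ m₃ →
    (m₁ >>= λ y₁ → mapᵐ (j₁ y₁) (m₂ >>= λ y₂ → mapᵐ (j₂ y₂) m₃)) ≡ liftA3 m₁ m₂ m₃
  liftA3-nestʳ e nothing   m₂        m₃        = refl
  liftA3-nestʳ e (just y₁) nothing   m₃        = refl
  liftA3-nestʳ e (just y₁) (just y₂) nothing   = refl
  liftA3-nestʳ e (just y₁) (just y₂) (just y₃) = cong just (e y₁ y₂ y₃)

  liftA3-nestˡ : ∀ {Z : Set a} {j₁ : Y₁ → Y₂ → Z} {j₂ : Z → Y₃ → R} →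
    (∀ y₁ y₂ y₃ → j₂ (j₁ y₁ y₂) y₃ ≡ j y₁ y₂ y₃) → ∀ m₁ m₂ m₃ →
    ((m₁ >>= λ y₁ → mapᵐ (j₁ y₁) m₂) >>= λ z → mapᵐ (j₂ z) m₃) ≡ liftA3 m₁ m₂ m₃
  liftA3-nestˡ e nothing   m₂        m₃        = refl
  liftA3-nestˡ e (just y₁) nothing   m₃        = refl
  liftA3-nestˡ e (just y₁) (just y₂) nothing   = refl
  liftA3-nestˡ e (just y₁) (just y₂) (just y₃) = cong just (e y₁ y₂ y₃)

module _ {a} {A B : Set a} where

  bind-cong : ∀ (m : Maybe A) {f g : A → Maybe B} → (∀ x → f x ≡ g x) → (m >>= f) ≡ (m >>= g)
  bind-cong nothing  e = refl
  bind-cong (just x) e = e x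

  bind-nothing : ∀ (m : Maybe A) → (m >>= λ _ → nothing {A = B}) ≡ nothing
  bind-nothing nothing  = refl
  bind-nothing (just _) = refl

module _ {a} {X₁ X₂ X₃ Y Z R : Set a} where

  bind-flattenʳ : ∀ {V : Set a} (m : Maybe (X₁ × V)) (n : V → Maybe (X₂ × X₃))
    (f : X₁ → Maybe Y) (j : Y → Z → R) (K : X₂ × X₃ → Maybe Z) →
    (m >>= λ (x₁ , v) → f x₁ >>= λ y → mapᵐ (j y) (n v >>= K))
    ≡ ((m >>= λ (x₁ , v) → n v >>= λ (x₂ , x₃) → just (x₁ , x₂ , x₃))
         >>= λ (x₁ , x₂ , x₃) → f x₁ >>= λ y → mapᵐ (j y) (K (x₂ , x₃)))
  bind-flattenʳ nothing         n f j K = refl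
  bind-flattenʳ (just (x₁ , v)) n f j K with n v
  ... | nothing = bind-nothing (f x₁)
  ... | just _  = refl

  bind-flattenˡ : ∀ {W : Set a} (m : Maybe (W × X₃)) (n : W → Maybe (X₁ × X₂))
    (K : X₁ × X₂ → Maybe Y) (k : X₃ → Maybe Z) (j : Y → Z → R) →
    (m >>= λ (w , x₃) → (n w >>= K) >>= λ y → mapᵐ (j y) (k x₃))
    ≡ ((m >>= λ (w , x₃) → n w >>= λ (x₁ , x₂) → just (x₁ , x₂ , x₃))
         >>= λ (x₁ , x₂ , x₃) → K (x₁ , x₂) >>= λ y → mapᵐ (j y) (k x₃))
  bind-flattenˡ nothing         n K k j = refl
  bind-flattenˡ (just (w , x₃)) n K k j with n w
  ... | nothing = refl
  ... | just _  = refl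

module _ {n ℓ} (H : LinHopfMonoid n ℓ) where
  open LinHopfMonoid H
  open Iterated H

  Δ-μ : ∀ {S A U} (p : Split S A U) (a : h A) (b : h U) → Δ p (μ p a b) ≡ just (a , b)
  Δ-μ p a b = begin
    Δ p (μ p a b)
      ≡⟨ compat p p split-∅ʳ split-∅ˡ split-∅ʳ split-∅ˡ a b ⟩
    (Δ split-∅ʳ a >>= λ (a₁ , a₂) → Δ split-∅ˡ b >>= λ (b₁ , b₂) →
       just (μ split-∅ʳ a₁ b₁ , μ split-∅ˡ a₂ b₂))
      ≡⟨ cong₂ (λ ma mb → ma >>= λ (a₁ , a₂) → mb >>= λ (b₁ , b₂) →
                  just (μ split-∅ʳ a₁ b₁ , μ split-∅ˡ a₂ b₂))
               (counitʳ split-∅ʳ a) (counitˡ split-∅ˡ b) ⟩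
    just (μ split-∅ʳ a one , μ split-∅ˡ one b)
      ≡⟨ cong₂ (λ a' b' → just (a' , b')) (unitʳ split-∅ʳ a) (unitˡ split-∅ˡ b) ⟩
    just (a , b) ∎
    where open ≡-Reasoning

  μ⊗ : ∀ {S A U} → Split S A U → Maybe (h A) → Maybe (h U) → Maybe (h S)
  μ⊗ p ma mu = ma >>= λ a → mapᵐ (μ p a) mu

  cut⊗ : ∀ {S A U} → Split S A U →
    (h A → Maybe (h A)) → (h U → Maybe (h U)) → h S → Maybe (h S)
  cut⊗ p f g x = Δ p x >>= λ (a , u) → μ⊗ p (f a) (g u)

  cut-cons : ∀ {S A U} (p : Split S A U) (ne : Nonempty A) (F : Comp U) x →
    cut (cons A p ne F) x ≡ cut⊗ p just (cut F) x
  cut-cons p ne F x with Δ p x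
  ... | nothing      = refl
  ... | just (a , u) with Δ* F u
  ...   | nothing = refl
  ...   | just _  = refl

  cut⊗-cong : ∀ {S A U} (p : Split S A U) {f f' g g'} →
    (∀ a → f a ≡ f' a) → (∀ u → g u ≡ g' u) → ∀ x → cut⊗ p f g x ≡ cut⊗ p f' g' x
  cut⊗-cong p ef eg x = bind-cong (Δ p x) λ (a , u) → cong₂ (μ⊗ p) (ef a) (eg u)

  cut⊗-at : ∀ {S A U} (p : Split S A U) f g {x a u} →
    Δ p x ≡ just (a , u) → cut⊗ p f g x ≡ μ⊗ p (f a) (g u)
  cut⊗-at p f g e = cong (_>>= _) e

  cut⊗-μ : ∀ {S A U} (p : Split S A U) f g a u → cut⊗ p f g (μ p a u) ≡ μ⊗ p (f a) (g u)
  cut⊗-μ p f g a u = cut⊗-at p f g (Δ-μ p a u)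

  cut⊗-assoc : ∀ {S B V C W Y} (q : Split S B V) (p : Split V C W) (r : Split S Y W) (s : Split Y B C)
    f g k x → cut⊗ q f (cut⊗ p g k) x ≡ cut⊗ r (cut⊗ s f g) k x
  cut⊗-assoc {S} {B} {V} {C} {W} q p r s f g k x = begin
    cut⊗ q f (cut⊗ p g k) x
      ≡⟨ bind-flattenʳ (Δ q x) (Δ p) f (μ q) (λ (c , w) → μ⊗ p (g c) (k w)) ⟩
    (Δ₃ˡ >>= λ (b , c , w) → μ⊗ q (f b) (μ⊗ p (g c) (k w)))
      ≡⟨ bind-cong Δ₃ˡ (λ (b , c , w) →
           liftA3-nestʳ j (λ b c w → assoc q p r s b c w) (f b) (g c) (k w)) ⟩
    (Δ₃ˡ >>= product)
      ≡⟨ cong (_>>= product) (coassoc q p r s x) ⟩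
    (Δ₃ʳ >>= product)
      ≡⟨ bind-cong Δ₃ʳ (λ (b , c , w) → liftA3-nestˡ j (λ _ _ _ → refl) (f b) (g c) (k w)) ⟨
    (Δ₃ʳ >>= λ (b , c , w) → μ⊗ r (μ⊗ s (f b) (g c)) (k w))
      ≡⟨ bind-flattenˡ (Δ r x) (Δ s) (λ (b , c) → μ⊗ s (f b) (g c)) k (μ r) ⟨
    cut⊗ r (cut⊗ s f g) k x ∎
    where
    open ≡-Reasoning
    Δ₃ˡ Δ₃ʳ : Maybe (h B × h C × h W)
    Δ₃ˡ = Δ q x >>= λ (b , v) → Δ p v >>= λ (c , w) → just (b , c , w)
    Δ₃ʳ = Δ r x >>= λ (y , w) → Δ s y >>= λ (b , c) → just (b , c , w)
    j : h B → h C → h W → h S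
    j b c w = μ r (μ s b c) w
    product : h B × h C × h W → Maybe (h S)
    product (b , c , w) = liftA3 j (f b) (g c) (k w)

  μ⊗-just⁻ : ∀ {S A U} (p : Split S A U) ma mu {y} → μ⊗ p ma mu ≡ just y →
    ∃[ a ] ∃[ u ] ma ≡ just a × mu ≡ just u × μ p a u ≡ y
  μ⊗-just⁻ p (just a) (just u) refl = a , u , refl , refl , refl

  cut⊗-just⁻ : ∀ {S A U} (p : Split S A U) f g x {y} → cut⊗ p f g x ≡ just y →
    ∃[ a ] ∃[ u ] Δ p x ≡ just (a , u) × μ⊗ p (f a) (g u) ≡ just y
  cut⊗-just⁻ p f g x e with Δ p x
  ... | just (a , u) = a , u , refl , e

  record Factorisation {S A U} (F : Comp S) (p : Split S A U) : Set ℓ where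
    field
      left   : Comp A
      right  : Comp U
      cut-factor : ∀ x → cut F x ≡ cut⊗ p (cut left) (cut right) x

  open Factorisation

  factorise : ∀ {S} (F : Comp S) xs ys → blocks F ≡ xs ++ ys → xs ≢ [] → ys ≢ [] →
    ∃[ A ] ∃[ U ] Σ (Split S A U) λ p → Σ (Factorisation F p) λ φ →
      blocks (left φ) ≡ xs × blocks (right φ) ≡ ys
  factorise F                 []             ys       _ xs≢[] _     = contradiction refl xs≢[]
  factorise F                 xs             []       _ _     ys≢[] = contradiction refl ys≢[]
  factorise [ _ ]             (_ ∷ [])       (_ ∷ _)  ()
  factorise [ _ ]             (_ ∷ _ ∷ _)    _        ()
  factorise (cons B q ne F')  (_ ∷ [])       (_ ∷ _)  e _ _ =
    B , _ , q , record { left = [ ne ] ; right = F' ; cut-factor = cut-cons q ne F' } ,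
    cong (_∷ []) (∷-injectiveˡ e) , ∷-injectiveʳ e
  factorise (cons B q ne F')  (_ ∷ x ∷ xs)   ys       e _ ys≢[]
    with factorise F' (x ∷ xs) ys (∷-injectiveʳ e) (λ ()) ys≢[] | ∷-injectiveˡ e
  ... | _ , U , p , φ , eˡ , eʳ | refl with split-assoc q p
  ...   | Y , r , s = Y , U , r , φ' , cong (B ∷_) eˡ , eʳ
    where
    φ' : Factorisation (cons B q ne F') r
    φ' = record { left = cons B s ne (left φ) ; right = right φ ; cut-factor = λ x → begin
      cut (cons B q ne F') x
        ≡⟨ cut-cons q ne F' x ⟩
      cut⊗ q just (cut F') x
        ≡⟨ cut⊗-cong q {f = just} (λ _ → refl) (cut-factor φ) x ⟩
      cut⊗ q just (cut⊗ p (cut (left φ)) (cut (right φ))) x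
        ≡⟨ cut⊗-assoc q p r s just (cut (left φ)) (cut (right φ)) x ⟩
      cut⊗ r (cut⊗ s just (cut (left φ))) (cut (right φ)) x
        ≡⟨ cut⊗-cong r {g = cut (right φ)} (cut-cons s ne (left φ)) (λ _ → refl) x ⟨
      cut⊗ r (cut (cons B s ne (left φ))) (cut (right φ)) x ∎ }
      where open ≡-Reasoning

  ≼-cons⇒factorisation : ∀ {S A U} (F : Comp S) (p : Split S A U) (ne : Nonempty A) (G : Comp U) →
    F ≼ cons A p ne G → Σ (Factorisation F p) λ φ → right φ ≼ G
  ≼-cons⇒factorisation F p ne G ([] , _ , _ , ())
  ≼-cons⇒factorisation {A = A} F p ne G (g ∷ Gs , g≢[] ∷ Gs≢[] , eF , eG)
    with factorise F g (concat Gs) (sym eF) g≢[] (concat-≢[] G Gs≢[] (∷-injectiveʳ eG))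
  ... | A' , _ , p' , φ , eˡ , eʳ with A'≡A
    where
    A'≡A : A' ≡ A
    A'≡A = trans (sym (⋃-blocks (left φ))) (trans (cong ⋃ eˡ) (∷-injectiveˡ eG))
  ... | refl with split-determinesʳ p' p
  ... | refl with split-irrelevant p' p
  ... | refl = φ , Gs , Gs≢[] , sym eʳ , ∷-injectiveʳ eG

  cut-coarser-of-cut : ∀ {S} {F G : Comp S} → F ≼ G →
    ∀ {x y} → cut F x ≡ just y → cut G y ≡ just y
  cut-coarser-of-cut {G = [ _ ]}          _   _ = refl
  cut-coarser-of-cut {F = F} {G = cons A p ne G'} F≼G {x} cutFx
    with ≼-cons⇒factorisation F p ne G' F≼G
  ... | φ , right≼G'
    with cut⊗-just⁻ p (cut (left φ)) (cut (right φ)) x (trans (sym (cut-factor φ x)) cutFx)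
  ... | a , u , _ , e with μ⊗-just⁻ p (cut (left φ) a) (cut (right φ) u) e
  ... | a' , u' , _ , cut-u , refl = begin
    cut (cons A p ne G') (μ p a' u')   ≡⟨ cut-cons p ne G' (μ p a' u') ⟩
    cut⊗ p just (cut G') (μ p a' u')   ≡⟨ cut⊗-μ p just (cut G') a' u' ⟩
    mapᵐ (μ p a') (cut G' u')          ≡⟨ cong (mapᵐ (μ p a')) (cut-coarser-of-cut right≼G' cut-u) ⟩
    just (μ p a' u')                   ∎
    where open ≡-Reasoning

  cut-finer-of-cut : ∀ {S} {B A : Comp S} → B ≼ A → ∀ {x y} → cut A x ≡ just y → cut B y ≡ cut B x
  cut-finer-of-cut {A = [ _ ]}          _   refl = refl
  cut-finer-of-cut {B = B} {A = cons A₁ {U₁} p ne A'} B≼A {x} cutAx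
    with ≼-cons⇒factorisation B p ne A' B≼A
  ... | φ , right≼A' with cut⊗-just⁻ p just (cut A') x (trans (sym (cut-cons p ne A' x)) cutAx)
  ... | a , u , Δx , e with μ⊗-just⁻ p (just a) (cut A' u) e
  ... | .a , u' , refl , cut-u , refl = begin
    cut B (μ p a u')                  ≡⟨ cut-factor φ (μ p a u') ⟩
    cut⊗ p L R (μ p a u')             ≡⟨ cut⊗-μ p L R a u' ⟩
    μ⊗ p (L a) (R u')                 ≡⟨ cong (μ⊗ p (L a)) (cut-finer-of-cut right≼A' cut-u) ⟩
    μ⊗ p (L a) (R u)                  ≡⟨ cut⊗-at p L R Δx ⟨
    cut⊗ p L R x                      ≡⟨ cut-factor φ x ⟨
    cut B x                           ∎
    where
    open ≡-Reasoning
    L : h A₁ → Maybe (h A₁)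
    L = cut (left φ)
    R : h U₁ → Maybe (h U₁)
    R = cut (right φ)

  cut≡just⇒Δ*≢nothing : ∀ {S} (F : Comp S) {x y} → cut F x ≡ just y → Δ* F x ≢ nothing
  cut≡just⇒Δ*≢nothing F cutFx Δx≡nothing =
    contradiction (trans (sym cutFx) (cong (mapᵐ (μ* F)) Δx≡nothing)) λ ()

  cut-between : ∀ {S} {Λ B A : Comp S} → Λ ≼ B → B ≼ A → ∀ {x y} →
    cut Λ x ≡ just y → cut A x ≡ just y → cut B x ≡ just y
  cut-between Λ≼B B≼A cutΛx cutAx =
    trans (sym (cut-finer-of-cut B≼A cutAx)) (cut-coarser-of-cut Λ≼B cutΛx)

lemma2p3 : ∀ {n : ℕ} {ℓ : Level} (H : LinHopfMonoid n ℓ) →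
    let open LinHopfMonoid H
        open Iterated H
    in (I : Subset n) (α β : List (Fin n)) → IsLinOrd I α → IsLinOrd I β →
       (x y : h I) (Λ : Comp I) →
       InC α x β y Λ → (∀ A → InC α x β y A → Λ ≼ A) →
       ∀ A → InC α x β y A → ∀ B → Λ ≼ B → B ≼ A → InC α x β y B
lemma2p3 H I α β _ _ x y Λ (_ , αΛ≡β , cutΛ) _ A (_ , αA≡β , cutA) B Λ≼B B≼A =
  cut≡just⇒Δ*≢nothing H B cutB , αB≡β , cutB
  where
  cutB : Iterated.cut H B x ≡ just y
  cutB = cut-between H Λ≼B B≼A cutΛ cutA
  αB≡β : orderOn α B ≡ β
  αB≡β = trans (orderOn-between α Λ≼B B≼A (trans αΛ≡β (sym αA≡β))) αA≡β
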